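{- Let $X$ be an $r$-regular graph that has a dominatable partition with $s$ parts. Then $-1$ is an eigenvalue of the adjacency matrix of $X$ with multiplicity at least $s-1$.
   Context: A partition of $V(X)$ into cells $C_1,\ldots,C_s$ is equitable if for all $i,l$ the number $b_{il}$ of neighbours in $C_l$ of a vertex $u\in C_i$ depends only on $i$ and $l$ (not on $u$). A dominatable partition is an equitable partition $C_1,\ldots,C_s$ such that for each $1\leq l\leq s$ there is a value $a_l$ with $b_{il}=a_l$ for all $i\neq l$ and $b_{ll}=a_l-1$; i.e., every vertex outside $C_l$ has exactly $a_l$ neighbours in $C_l$ and every vertex in $C_l$ has exactly $a_l-1$ neighbours in $C_l$. -}

module Defs where

open import Data.Nat using (ℕ; zero; suc; _+_)
open import Data.Bool using (Bool; true; false; if_then_else_; _∧_)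
open import Data.Fin using (Fin; zero; suc; _≟_)
open import Data.Product using (Σ; _×_; ∃)
open import Relation.Nullary using (¬_; does)
open import Relation.Binary.PropositionalEquality using (_≡_)
open import Data.Rational using (ℚ; 0ℚ; 1ℚ; -_) renaming (_+_ to _+ℚ_; _*_ to _*ℚ_)

sumℕ : ∀ {n} → (Fin n → ℕ) → ℕ
sumℕ {zero}  f = 0
sumℕ {suc n} f = f zero + sumℕ (λ i → f (suc i))

sumℚ : ∀ {n} → (Fin n → ℚ) → ℚ
sumℚ {zero}  f = 0ℚ
sumℚ {suc n} f = f zero +ℚ sumℚ (λ i → f (suc i))

record Graph (n : ℕ) : Set where
  field
    adj   : Fin n → Fin n → Bool
    sym   : ∀ u v → adj u v ≡ adj v u
    irrefl : ∀ u → adj u u ≡ false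

open Graph public

degree : ∀ {n} → Graph n → Fin n → ℕ
degree X u = sumℕ (λ v → if adj X u v then 1 else 0)

Regular : ∀ {n} → Graph n → ℕ → Set
Regular X r = ∀ u → degree X u ≡ r

record Partition (n s : ℕ) : Set where
  field
    cell     : Fin n → Fin s
    nonempty : ∀ (i : Fin s) → ∃ λ u → cell u ≡ i

open Partition public

nbrsIn : ∀ {n s} → Graph n → Partition n s → Fin n → Fin s → ℕ
nbrsIn X P u l = sumℕ (λ v → if adj X u v ∧ does (cell P v ≟ l) then 1 else 0)

IsEquitableWith : ∀ {n s} → Graph n → Partition n s → (Fin s → Fin s → ℕ) → Set
IsEquitableWith X P b = ∀ u l → nbrsIn X P u l ≡ b (cell P u) l

Equitable : ∀ {n s} → Graph n → Partition n s → Set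
Equitable {s = s} X P = Σ (Fin s → Fin s → ℕ) λ b → IsEquitableWith X P b

Dominatable : ∀ {n s} → Graph n → Partition n s → Set
Dominatable {s = s} X P =
  Σ (Fin s → Fin s → ℕ) λ b → IsEquitableWith X P b ×
  Σ (Fin s → ℕ) λ a → ∀ i l → (¬ (i ≡ l) → b i l ≡ a l) × (b l l + 1 ≡ a l)

adjℚ : ∀ {n} → Graph n → Fin n → Fin n → ℚ
adjℚ X u v = if adj X u v then 1ℚ else 0ℚ

mulVec : ∀ {n} → Graph n → (Fin n → ℚ) → (Fin n → ℚ)
mulVec X x u = sumℚ (λ v → adjℚ X u v *ℚ x v)

IsEigenvector : ∀ {n} → Graph n → ℚ → (Fin n → ℚ) → Set
IsEigenvector X λ₀ x = ∀ u → mulVec X x u ≡ λ₀ *ℚ x u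

LinearlyIndependent : ∀ {n k} → (Fin k → Fin n → ℚ) → Set
LinearlyIndependent {n} {k} x =
  ∀ (c : Fin k → ℚ) → (∀ u → sumℚ (λ j → c j *ℚ x j u) ≡ 0ℚ) → ∀ j → c j ≡ 0ℚ

EigenvalueMultAtLeast : ∀ {n} → Graph n → ℚ → ℕ → Set
EigenvalueMultAtLeast {n} X λ₀ m =
  Σ (Fin m → Fin n → ℚ) λ x → LinearlyIndependent x × (∀ j → IsEigenvector X λ₀ (x j))

-- Let χₗ be the characteristic vector of the l-th cell and A the adjacency
-- matrix. Dominatability says exactly that (A + I) χₗ = aₗ 𝟙 for every l, so
-- for a fixed cell t the s − 1 vectors a_t χⱼ − aⱼ χ_t (j ≠ t) are killed by
-- A + I, i.e. are (−1)-eigenvectors. They are independent because on a vertex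
-- of cell j only the j-th one is nonzero, with value a_t = b_tt + 1 > 0.
module Submission where

open import Defs hiding (sym)
open import Data.Nat using (ℕ; _∸_)
open import Data.Rational using (-_; 1ℚ)

import Data.Nat as ℕ
import Data.Nat.Properties as ℕ
open import Data.Bool using (Bool; true; false; if_then_else_; _∧_)
open import Data.Fin using (Fin; zero; suc; _≟_; inject₁; fromℕ)
open import Data.Fin.Properties using (suc-injective; fromℕ≢inject₁; inject₁-injective)
open import Function using (_∘_)
open import Data.Product using (Σ; _×_; _,_; proj₁; proj₂)
open import Relation.Nullary using (¬_; does; yes; no; contradiction)
open import Relation.Binary.PropositionalEquality
  using (_≡_; _≢_; refl; sym; trans; cong; cong₂; subst; module ≡-Reasoning)
open import Data.Rational using (ℚ; 0ℚ; _+_; _*_; _-_; NonZero; NonNegative; 1/_)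
open import Data.Rational.Properties
  using (+-identityˡ; +-identityʳ; +-assoc; *-identityʳ; *-identityˡ; *-zeroˡ; *-zeroʳ; *-assoc; *-inverseʳ;
         nonNeg+nonNeg⇒nonNeg; pos+nonNeg⇒pos; pos⇒nonZero)
open import Data.Rational.Solver using (module +-*-Solver)
open +-*-Solver

toℚ : ℕ → ℚ
toℚ ℕ.zero    = 0ℚ
toℚ (ℕ.suc n) = 1ℚ + toℚ n

toℚ-+ : ∀ m n → toℚ (m ℕ.+ n) ≡ toℚ m + toℚ n
toℚ-+ ℕ.zero    n = sym (+-identityˡ (toℚ n))
toℚ-+ (ℕ.suc m) n = trans (cong (1ℚ +_) (toℚ-+ m n)) (sym (+-assoc 1ℚ (toℚ m) (toℚ n)))

toℚ-nonNeg : ∀ n → NonNegative (toℚ n)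
toℚ-nonNeg ℕ.zero    = _
toℚ-nonNeg (ℕ.suc n) = nonNeg+nonNeg⇒nonNeg 1ℚ (toℚ n) {{toℚ-nonNeg n}}

toℚ-suc-nonZero : ∀ n → NonZero (toℚ (ℕ.suc n))
toℚ-suc-nonZero n = pos⇒nonZero (toℚ (ℕ.suc n)) {{pos+nonNeg⇒pos 1ℚ (toℚ n) {{toℚ-nonNeg n}}}}

*-zero-cancelʳ : ∀ p q .{{_ : NonZero q}} → p * q ≡ 0ℚ → p ≡ 0ℚ
*-zero-cancelʳ p q pq≡0 = begin
  p               ≡⟨ sym (*-identityʳ p) ⟩
  p * 1ℚ          ≡⟨ cong (p *_) (sym (*-inverseʳ q)) ⟩
  p * (q * 1/ q)  ≡⟨ sym (*-assoc p q (1/ q)) ⟩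
  (p * q) * 1/ q  ≡⟨ cong (_* 1/ q) pq≡0 ⟩
  0ℚ * 1/ q       ≡⟨ *-zeroˡ (1/ q) ⟩
  0ℚ              ∎
  where open ≡-Reasoning

indicator : Bool → ℚ
indicator b = if b then 1ℚ else 0ℚ

indicator-∧ : ∀ a b → indicator a * indicator b ≡ indicator (a ∧ b)
indicator-∧ true  true  = *-identityˡ 1ℚ
indicator-∧ true  false = *-identityˡ 0ℚ
indicator-∧ false b     = *-zeroˡ (indicator b)

sumℚ-cong : ∀ {n} {f g : Fin n → ℚ} → (∀ v → f v ≡ g v) → sumℚ f ≡ sumℚ g
sumℚ-cong {ℕ.zero}  f≗g = refl
sumℚ-cong {ℕ.suc n} f≗g = cong₂ _+_ (f≗g zero) (sumℚ-cong (λ v → f≗g (suc v)))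

sumℚ-indicator : ∀ {n} (p : Fin n → Bool) →
  sumℚ (λ v → indicator (p v)) ≡ toℚ (sumℕ (λ v → if p v then 1 else 0))
sumℚ-indicator {ℕ.zero}  p = refl
sumℚ-indicator {ℕ.suc n} p with p zero
... | true  = cong (1ℚ +_) (sumℚ-indicator (λ v → p (suc v)))
... | false = trans (+-identityˡ _) (sumℚ-indicator (λ v → p (suc v)))

sumℚ-zero : ∀ {n} (f : Fin n → ℚ) → (∀ v → f v ≡ 0ℚ) → sumℚ f ≡ 0ℚ
sumℚ-zero {ℕ.zero}  f f≗0 = refl
sumℚ-zero {ℕ.suc n} f f≗0 =
  trans (cong₂ _+_ (f≗0 zero) (sumℚ-zero (λ v → f (suc v)) (λ v → f≗0 (suc v)))) (+-identityˡ 0ℚ)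

sumℚ-single : ∀ {n} (f : Fin n → ℚ) j → (∀ i → i ≢ j → f i ≡ 0ℚ) → sumℚ f ≡ f j
sumℚ-single f zero    f≗0 =
  trans (cong (f zero +_) (sumℚ-zero (λ v → f (suc v)) (λ v → f≗0 (suc v) λ ()))) (+-identityʳ _)
sumℚ-single f (suc j) f≗0 =
  trans (cong (_+ sumℚ (λ v → f (suc v))) (f≗0 zero λ ()))
    (trans (+-identityˡ (sumℚ (λ v → f (suc v))))
      (sumℚ-single (λ v → f (suc v)) j (λ i i≢j → f≗0 (suc i) (λ e → i≢j (suc-injective e)))))

sumℚ-*-combination : ∀ {n} (f g h : Fin n → ℚ) (α β : ℚ) →
  sumℚ (λ v → f v * (α * g v - β * h v))
    ≡ α * sumℚ (λ v → f v * g v) - β * sumℚ (λ v → f v * h v)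
sumℚ-*-combination {ℕ.zero} f g h α β =
  solve 2 (λ α β → con 0ℚ := α :* con 0ℚ :- β :* con 0ℚ) refl α β
sumℚ-*-combination {ℕ.suc n} f g h α β =
  trans (cong (f zero * (α * g zero - β * h zero) +_)
              (sumℚ-*-combination (λ v → f (suc v)) (λ v → g (suc v)) (λ v → h (suc v)) α β))
    (solve 7 (λ f₀ g₀ h₀ α β G H →
                f₀ :* (α :* g₀ :- β :* h₀) :+ (α :* G :- β :* H)
                  := α :* (f₀ :* g₀ :+ G) :- β :* (f₀ :* h₀ :+ H))
             refl (f zero) (g zero) (h zero) α β
             (sumℚ (λ v → f (suc v) * g (suc v))) (sumℚ (λ v → f (suc v) * h (suc v))))

combination-isEigenvector : ∀ {n} (X : Graph n) (x y : Fin n → ℚ) (α β : ℚ) →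
  (∀ u → mulVec X x u + x u ≡ α) → (∀ u → mulVec X y u + y u ≡ β) →
  IsEigenvector X (- 1ℚ) (λ u → β * x u - α * y u)
combination-isEigenvector X x y α β Ax+x≡α Ay+y≡β u =
  trans (sumℚ-*-combination (adjℚ X u) x y β α)
        (eliminate (Ax+x≡α u) (Ay+y≡β u))
  where
  eliminate : ∀ {α β} → mulVec X x u + x u ≡ α → mulVec X y u + y u ≡ β →
    β * mulVec X x u - α * mulVec X y u ≡ - 1ℚ * (β * x u - α * y u)
  eliminate refl refl =
    solve 4 (λ Ax x Ay y → (Ay :+ y) :* Ax :- (Ax :+ x) :* Ay
                             := (:- con 1ℚ) :* ((Ay :+ y) :* x :- (Ax :+ x) :* y))
          refl (mulVec X x u) (x u) (mulVec X y u) (y u)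

separated⇒linearlyIndependent : ∀ {n k} (x : Fin k → Fin n → ℚ) →
  (∀ j → Σ (Fin n) λ u → NonZero (x j u) × (∀ i → i ≢ j → x i u ≡ 0ℚ)) →
  LinearlyIndependent x
separated⇒linearlyIndependent x separated c Σcx≡0 j with separated j
... | u , x[j,u]≢0 , x[i,u]≡0 = *-zero-cancelʳ (c j) (x j u) {{x[j,u]≢0}} (begin
  c j * x j u                    ≡⟨ sumℚ-single (λ i → c i * x i u) j cx≗0 ⟨
  sumℚ (λ i → c i * x i u)       ≡⟨ Σcx≡0 u ⟩
  0ℚ                             ∎)
  where
  open ≡-Reasoning
  cx≗0 : ∀ i → i ≢ j → c i * x i u ≡ 0ℚ
  cx≗0 i i≢j = trans (cong (c i *_) (x[i,u]≡0 i i≢j)) (*-zeroʳ (c i))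

cellVector : ∀ {n s} → Partition n s → Fin s → Fin n → ℚ
cellVector P l v = indicator (does (cell P v ≟ l))

cellVector-≡ : ∀ {n s} (P : Partition n s) {l u} → cell P u ≡ l → cellVector P l u ≡ 1ℚ
cellVector-≡ P {l} {u} cu≡l with cell P u ≟ l
... | yes _    = refl
... | no cu≢l = contradiction cu≡l cu≢l

cellVector-≢ : ∀ {n s} (P : Partition n s) {l u} → cell P u ≢ l → cellVector P l u ≡ 0ℚ
cellVector-≢ P {l} {u} cu≢l with cell P u ≟ l
... | yes cu≡l = contradiction cu≡l cu≢l
... | no _     = refl

mulVec-cellVector : ∀ {n s} (X : Graph n) (P : Partition n s) u l →
  mulVec X (cellVector P l) u ≡ toℚ (nbrsIn X P u l)
mulVec-cellVector X P u l =
  trans (sumℚ-cong (λ v → indicator-∧ (adj X u v) (does (cell P v ≟ l))))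
        (sumℚ-indicator (λ v → adj X u v ∧ does (cell P v ≟ l)))

ClosedNbhdsMeetCells : ∀ {n s} → Graph n → Partition n s → (Fin s → ℕ) → Set
ClosedNbhdsMeetCells X P a = ∀ u l →
  nbrsIn X P u l ℕ.+ (if does (cell P u ≟ l) then 1 else 0) ≡ a l

dominatable⇒closedNbhdsMeetCells : ∀ {n s} (X : Graph n) (P : Partition n s) b a →
  IsEquitableWith X P b → (∀ i l → (¬ i ≡ l → b i l ≡ a l) × (b l l ℕ.+ 1 ≡ a l)) →
  ClosedNbhdsMeetCells X P a
dominatable⇒closedNbhdsMeetCells X P b a equitable domination u l
  rewrite equitable u l with cell P u ≟ l
... | yes refl = proj₂ (domination l l)
... | no cu≢l  = trans (ℕ.+-identityʳ _) (proj₁ (domination (cell P u) l) cu≢l)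

mulVec-cellVector+cellVector : ∀ {n s} (X : Graph n) (P : Partition n s) {a} →
  ClosedNbhdsMeetCells X P a → ∀ l u → mulVec X (cellVector P l) u + cellVector P l u ≡ toℚ (a l)
mulVec-cellVector+cellVector X P dominatable l u with cell P u ≟ l | dominatable u l
... | yes _ | closed = trans (cong₂ _+_ (mulVec-cellVector X P u l) (sym (+-identityʳ 1ℚ)))
                             (trans (sym (toℚ-+ (nbrsIn X P u l) 1)) (cong toℚ closed))
... | no _  | closed = trans (cong (_+ 0ℚ) (mulVec-cellVector X P u l))
                             (trans (+-identityʳ _) (cong toℚ (trans (sym (ℕ.+-identityʳ _)) closed)))

cellDifference : ∀ {n s} → Partition n s → (Fin s → ℚ) → Fin s → Fin s → Fin n → ℚ
cellDifference P α t l u = α t * cellVector P l u - α l * cellVector P t u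

cellDifference-isEigenvector : ∀ {n s} (X : Graph n) (P : Partition n s) {a} →
  ClosedNbhdsMeetCells X P a → ∀ t l → IsEigenvector X (- 1ℚ) (cellDifference P (toℚ ∘ a) t l)
cellDifference-isEigenvector X P dominatable t l =
  combination-isEigenvector X (cellVector P l) (cellVector P t) _ _
    (mulVec-cellVector+cellVector X P dominatable l) (mulVec-cellVector+cellVector X P dominatable t)

cellDifference-inCell : ∀ {n s} (P : Partition n s) α {t l u} →
  cell P u ≡ l → cell P u ≢ t → cellDifference P α t l u ≡ α t
cellDifference-inCell P α {t} {l} cu≡l cu≢t
  rewrite cellVector-≡ P cu≡l | cellVector-≢ P cu≢t =
  solve 2 (λ αₜ αₗ → αₜ :* con 1ℚ :- αₗ :* con 0ℚ := αₜ) refl (α t) (α l)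

cellDifference-outsideCells : ∀ {n s} (P : Partition n s) α {t l u} →
  cell P u ≢ l → cell P u ≢ t → cellDifference P α t l u ≡ 0ℚ
cellDifference-outsideCells P α {t} {l} cu≢l cu≢t
  rewrite cellVector-≢ P cu≢l | cellVector-≢ P cu≢t =
  solve 2 (λ αₜ αₗ → αₜ :* con 0ℚ :- αₗ :* con 0ℚ := con 0ℚ) refl (α t) (α l)

theorem4p1 : (n r s : ℕ) (X : Graph n) (P : Partition n s) →
    Regular X r → Dominatable X P →
    EigenvalueMultAtLeast X (- 1ℚ) (s ∸ 1)
theorem4p1 n r ℕ.zero X P _ _ = (λ ()) , (λ _ _ ()) , (λ ())
theorem4p1 n r (ℕ.suc m) X P _ (b , equitable , a , domination) =
  x , separated⇒linearlyIndependent x separated ,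
  (λ j → cellDifference-isEigenvector X P closedNbhds t (inject₁ j))
  where
  closedNbhds = dominatable⇒closedNbhdsMeetCells X P b a equitable domination
  t = fromℕ m
  x : Fin m → Fin n → ℚ
  x j = cellDifference P (toℚ ∘ a) t (inject₁ j)

  a[t]≢0 : NonZero (toℚ (a t))
  a[t]≢0 = subst (NonZero ∘ toℚ) (trans (ℕ.+-comm 1 (b t t)) (proj₂ (domination t t)))
                 (toℚ-suc-nonZero (b t t))

  separated : ∀ j → Σ (Fin n) λ u → NonZero (x j u) × (∀ i → i ≢ j → x i u ≡ 0ℚ)
  separated j with nonempty P (inject₁ j)
  ... | u , cu≡j =
    u , subst NonZero (sym (cellDifference-inCell P (toℚ ∘ a) cu≡j cu≢t)) a[t]≢0 ,
    λ i i≢j → cellDifference-outsideCells P (toℚ ∘ a)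
                (λ cu≡i → i≢j (inject₁-injective (trans (sym cu≡i) cu≡j))) cu≢t
    where
    cu≢t : cell P u ≢ t
    cu≢t cu≡t = fromℕ≢inject₁ (trans (sym cu≡t) cu≡j)
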